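{- Let $p,q\ge 3$ be coprime integers, and for an integer $r\ge 3$ coprime to $pq$ let $\chi_r$ be the characteristic function (on $\mathbb Z$) of the set $\{iqr+jrp+kpq: i,j,k\in\mathbb Z_{\ge 0}\}$. Suppose $r,s$ are integers coprime to $pq$ with $\max(p,q)<r<s$ and $r\equiv s\pmod{pq}$. Then \[ \chi_r(kr+j)=\chi_s(ks+j) \] for all integers $k<pq$ and $|j|<r$. Moreover, if $|j|<\min(r,pq)$ (and $k<pq$), then also \[ \chi_r(kr+j-r)=\chi_s(ks+j-r). \] -}

module Defs where

open import Data.Integer using (ℤ; +_; _+_; _*_)
open import Data.Nat using (ℕ)
open import Data.Product using (∃-syntax)
open import Relation.Binary.PropositionalEquality using (_≡_)

-- The set S(p,q,r) = { i*q*r + j*r*p + k*p*q : i,j,k ∈ ℤ_{≥0} } ⊆ ℤ.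
-- χ_r(n) = 1 iff InS p q r n; so "χ_r(a) = χ_s(b)" is rendered as
-- InS p q r a ⇔ InS p q s b.
InS : ℤ → ℤ → ℤ → ℤ → Set
InS p q r n = ∃[ i ] ∃[ j ] ∃[ k ]
  (n ≡ (+ i) * q * r + (+ j) * r * p + (+ k) * p * q)

module Submission where

-- Write P = p·q and A(i,j) = i·q + j·p.  By definition,
-- n ∈ S(p,q,x) iff for some i, j ≥ 0 the "residual" n − A(i,j)·x is a
-- non-negative multiple of P.  For n = K·x + c the residual is
-- (K − A)·x + c, and replacing x by y ≡ x (mod P) changes it by
-- (K − A)·(y − x), a multiple of P.  So membership transfers from
-- (x, K·x + c) to (y, K·y + c) as soon as the SIGN of d·x + c controls
-- the sign of d·y + c for every integer d; this is `transfer`.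
-- The sign condition is settled by two arithmetic facts: `ascend`
-- (x ≤ y and c < x) and `descend` (x ≤ y, c < y and −P < x + c, using
-- that a multiple of P exceeding −P is non-negative).  With (x, y) = (r, s)
-- and c = j resp. c = j − r, these give both parts of the theorem.

open import Defs
open import Data.Integer using (ℤ; +_; _+_; _-_; _*_; _<_; _≤_; -_; ∣_∣)
open import Data.Integer.Coprimality using (Coprime)
open import Data.Integer.Divisibility using (_∣_)
open import Data.Integer.Base using (_⊔_; _⊓_; +[1+_]; -[1+_]; +≤+; +<+; -≤-; -<-)
open import Data.Integer.Properties
open import Data.Integer.Tactic.RingSolver using (solve-∀)
import Data.Integer.Divisibility.Signed as Signed
open Signed using (divides; ∣ᵤ⇒∣; ∣m∣n⇒∣m+n; ∣n⇒∣m*n; ∣m⇒∣-m)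
open import Data.Nat using (ℕ; z≤n; s≤s)
open import Data.Product using (_×_; _,_; ∃-syntax)
open import Function.Bundles using (_⇔_; mk⇔; Equivalence)
open import Relation.Binary.PropositionalEquality
open import Relation.Nullary using (contradiction)

scale-mono : ∀ {x} d e → + 0 ≤ x → d ≤ e → d * x ≤ e * x
scale-mono {+ m} _ _ _ = *-monoʳ-≤-nonNeg (+ m)

-- If x ≥ 0, c < x and d·x + c ≥ 0, then d ≥ 0: for d ≤ −1 we would
-- have d·x + c ≤ −x + c < 0.
coefficient-nonneg : ∀ {x c} d → + 0 ≤ x → c < x → + 0 ≤ d * x + c → + 0 ≤ d
coefficient-nonneg (+ n) _ _ _ = +≤+ z≤n
coefficient-nonneg {x} {c} -[1+ n ] x≥0 c<x h = contradiction h (<⇒≱ negative)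
  where
  open ≤-Reasoning
  negative : -[1+ n ] * x + c < + 0
  negative = begin-strict
    -[1+ n ] * x + c  ≤⟨ +-monoˡ-≤ c (scale-mono -[1+ n ] -[1+ 0 ] x≥0 (-≤- z≤n)) ⟩
    -[1+ 0 ] * x + c  ≡⟨ cong (_+ c) (-1*i≡-i x) ⟩
    - x + c           <⟨ +-monoʳ-< (- x) c<x ⟩
    - x + x           ≡⟨ +-inverseˡ x ⟩
    + 0               ∎

factor-nonneg : ∀ {P} e → + 0 < P → + 0 ≤ e * P → + 0 ≤ e
factor-nonneg {+[1+ n ]} e _ h = *-cancelʳ-≤-pos (+ 0) e +[1+ n ] h
factor-nonneg {+ 0} e (+<+ ()) _

above-minus-one : ∀ e → -[1+ 0 ] < e → + 0 ≤ e
above-minus-one (+ _) _ = +≤+ z≤n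
above-minus-one -[1+ _ ] (-<- ())

multiple-nonneg : ∀ {P n} → + 0 < P → - P < n → P Signed.∣ n → + 0 ≤ n
multiple-nonneg { -[1+ _ ]} () _ _
multiple-nonneg {+ P} {n} _ -P<n (divides e refl) =
  subst (_≤ e * + P) (*-zeroˡ (+ P)) (scale-mono (+ 0) e (+≤+ z≤n) e≥0)
  where
  -1<e : -[1+ 0 ] < e
  -1<e = *-cancelʳ-<-nonNeg (+ P) (subst (_< e * + P) (sym (-1*i≡-i (+ P))) -P<n)
  e≥0 : + 0 ≤ e
  e≥0 = above-minus-one e -1<e

-- Sign transfer upwards: if x ≤ y and c < x, then d·x + c ≥ 0 forces
-- d ≥ 0, hence d·y + c ≥ d·x + c ≥ 0.
ascend : ∀ {x y c} → + 0 ≤ x → x ≤ y → c < x →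
  ∀ d → + 0 ≤ d * x + c → + 0 ≤ d * y + c
ascend {c = c} x≥0 x≤y c<x d h with coefficient-nonneg d x≥0 c<x h
... | +≤+ _ = ≤-trans h (+-monoˡ-≤ c (*-monoˡ-≤-nonNeg d x≤y))

-- Sign transfer downwards: if x ≤ y, c < y and −P < x + c, and d·x + c is
-- a multiple of P, then d·y + c ≥ 0 implies d·x + c ≥ 0.  Indeed d ≥ 0;
-- for d = 0 both sides equal c, and for d ≥ 1 we get d·x + c ≥ x + c > −P.
descend : ∀ {P x y c} → + 0 < P → + 0 ≤ x → x ≤ y → c < y → - P < x + c →
  ∀ d → P Signed.∣ (d * x + c) → + 0 ≤ d * y + c → + 0 ≤ d * x + c
descend {P} {x} {y} {c} P>0 x≥0 x≤y c<y -P<x+c d P∣dx+c h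
  with coefficient-nonneg d (≤-trans x≥0 x≤y) c<y h
descend {P} {x} {y} {c} _ _ _ _ _ (+ 0) _ h
  | +≤+ _ = subst (λ z → + 0 ≤ z + c) (trans (*-zeroˡ y) (sym (*-zeroˡ x))) h
descend {P} {x} {y} {c} P>0 x≥0 _ _ -P<x+c +[1+ m ] P∣dx+c _
  | +≤+ _ = multiple-nonneg P>0 (<-≤-trans -P<x+c x+c≤dx+c) P∣dx+c
  where
  x+c≤dx+c : x + c ≤ +[1+ m ] * x + c
  x+c≤dx+c = +-monoˡ-≤ c (subst (_≤ +[1+ m ] * x) (*-identityˡ x)
    (scale-mono (+ 1) +[1+ m ] x≥0 (+≤+ (s≤s z≤n))))

comb : ℤ → ℤ → ℕ → ℕ → ℤ
comb p q i j = + i * q + + j * p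

residual-of-element : ∀ i j k p q x →
  (i * q * x + j * x * p + k * p * q) - (i * q + j * p) * x ≡ k * (p * q)
residual-of-element = solve-∀

element-of-residual : ∀ i j k p q x →
  (i * q + j * p) * x + k * (p * q) ≡ i * q * x + j * x * p + k * p * q
element-of-residual = solve-∀

split-off : ∀ a b → a ≡ (a - b) + b
split-off = solve-∀

AdmissibleResidual : ℤ → ℤ → ℤ → ℤ → Set
AdmissibleResidual p q x n = ∃[ i ] ∃[ j ]
  ((p * q) Signed.∣ (n - comb p q i j * x) × + 0 ≤ n - comb p q i j * x)

InS⇔residual : ∀ {p q x n} → + 0 < p * q →
  InS p q x n ⇔ AdmissibleResidual p q x n
InS⇔residual {p} {q} {x} {n} P>0 = mk⇔ to from
  where
  to : InS p q x n → AdmissibleResidual p q x n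
  to (i , j , k , refl) = i , j , divides (+ k) residual ,
    subst (+ 0 ≤_) (sym residual) (subst (_≤ + k * (p * q)) (*-zeroˡ (p * q))
      (scale-mono (+ 0) (+ k) (<⇒≤ P>0) (+≤+ z≤n)))
    where
    residual : (+ i * q * x + + j * x * p + + k * p * q) - comb p q i j * x
                 ≡ + k * (p * q)
    residual = residual-of-element (+ i) (+ j) (+ k) p q x

  from : AdmissibleResidual p q x n → InS p q x n
  from (i , j , divides e R≡eP , R≥0) = i , j , ∣ e ∣ , (begin
    n                                        ≡⟨ split-off n (A * x) ⟩
    (n - A * x) + A * x                      ≡⟨ +-comm (n - A * x) (A * x) ⟩
    A * x + (n - A * x)                      ≡⟨ cong (_+_ (A * x)) R≡eP ⟩
    A * x + e * (p * q)                      ≡⟨ cong (λ z → A * x + z * (p * q)) e≡∣e∣ ⟩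
    A * x + + ∣ e ∣ * (p * q)                ≡⟨ element-of-residual (+ i) (+ j) (+ ∣ e ∣) p q x ⟩
    + i * q * x + + j * x * p + + ∣ e ∣ * p * q ∎)
    where
    open ≡-Reasoning
    A : ℤ
    A = comb p q i j
    e≡∣e∣ : e ≡ + ∣ e ∣
    e≡∣e∣ = sym (0≤i⇒+∣i∣≡i (factor-nonneg e P>0 (subst (+ 0 ≤_) R≡eP R≥0)))

affine-residual : ∀ K A x c → (K * x + c) - A * x ≡ (K - A) * x + c
affine-residual = solve-∀

shift-residual : ∀ d x y c → d * y + c ≡ (d * x + c) + d * (y - x)
shift-residual = solve-∀

transfer : ∀ {p q x y K c} → + 0 < p * q → (p * q) Signed.∣ (y - x) →
  (∀ d → (p * q) Signed.∣ (d * y + c) → + 0 ≤ d * x + c → + 0 ≤ d * y + c) →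
  InS p q x (K * x + c) → InS p q y (K * y + c)
transfer {p} {q} {x} {y} {K} {c} P>0 P∣y-x sign-transfer mem
  with Equivalence.to (InS⇔residual P>0) mem
... | i , j , P∣Rx , Rx≥0 =
  Equivalence.from (InS⇔residual P>0) (i , j , P∣Ry , Ry≥0)
  where
  A d : ℤ
  A = comb p q i j
  d = K - A
  P∣dx+c : (p * q) Signed.∣ (d * x + c)
  P∣dx+c = subst ((p * q) Signed.∣_) (affine-residual K A x c) P∣Rx
  P∣dy+c : (p * q) Signed.∣ (d * y + c)
  P∣dy+c = subst ((p * q) Signed.∣_) (sym (shift-residual d x y c))
    (∣m∣n⇒∣m+n P∣dx+c (∣n⇒∣m*n d P∣y-x))
  P∣Ry : (p * q) Signed.∣ ((K * y + c) - A * y)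
  P∣Ry = subst ((p * q) Signed.∣_) (sym (affine-residual K A y c)) P∣dy+c
  Ry≥0 : + 0 ≤ (K * y + c) - A * y
  Ry≥0 = subst (+ 0 ≤_) (sym (affine-residual K A y c))
    (sign-transfer d P∣dy+c (subst (+ 0 ≤_) (affine-residual K A x c) Rx≥0))

residue-invariance : ∀ {p q r s c} → + 0 < p * q → (p * q) Signed.∣ (s - r) →
  + 0 ≤ r → r ≤ s → c < r → - (p * q) < r + c →
  ∀ K → InS p q r (K * r + c) ⇔ InS p q s (K * s + c)
residue-invariance {p} {q} {r} {s} {c} P>0 P∣s-r r≥0 r≤s c<r -P<r+c K = mk⇔
  (transfer {K = K} P>0 P∣s-r (λ d _ → ascend r≥0 r≤s c<r d))
  (transfer {K = K} P>0 P∣r-s (descend P>0 r≥0 r≤s (<-≤-trans c<r r≤s) -P<r+c))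
  where
  P∣r-s : (p * q) Signed.∣ (r - s)
  P∣r-s = subst ((p * q) Signed.∣_) (negate-difference s r) (∣m⇒∣-m P∣s-r)
    where
    negate-difference : ∀ a b → - (a - b) ≡ b - a
    negate-difference = solve-∀

product-positive : ∀ {p q} → + 0 < p → + 0 < q → + 0 < p * q
product-positive {+[1+ a ]} {+[1+ b ]} _ _ = +<+ (s≤s z≤n)
product-positive {+ 0} (+<+ ()) _
product-positive {+[1+ a ]} {+ 0} _ (+<+ ())

lemma6 : (p q r s : ℤ) → + 3 ≤ p → + 3 ≤ q → Coprime p q →
    Coprime r (p * q) → Coprime s (p * q) →
    (p ⊔ q) < r → r < s → (p * q) ∣ (s - r) →
    ((k j : ℤ) → k < p * q → (- r) < j → j < r →
      InS p q r (k * r + j) ⇔ InS p q s (k * s + j))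
    × ((k j : ℤ) → k < p * q → (- (r ⊓ (p * q))) < j → j < (r ⊓ (p * q)) →
      InS p q r (k * r + j - r) ⇔ InS p q s (k * s + j - r))
lemma6 p q r s p≥3 q≥3 _ _ _ p⊔q<r r<s pq∣s-r = part₁ , part₂
  where
  p>0 : + 0 < p
  p>0 = <-≤-trans (+<+ (s≤s z≤n)) p≥3
  P>0 : + 0 < p * q
  P>0 = product-positive p>0 (<-≤-trans (+<+ (s≤s z≤n)) q≥3)
  r>0 : + 0 < r
  r>0 = <-trans (<-≤-trans p>0 (i≤i⊔j p q)) p⊔q<r
  invariance : ∀ {c} → c < r → - (p * q) < r + c →
    ∀ K → InS p q r (K * r + c) ⇔ InS p q s (K * s + c)
  invariance = residue-invariance P>0 (∣ᵤ⇒∣ pq∣s-r) (<⇒≤ r>0) (<⇒≤ r<s)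

  -- c = j: here r + j > 0 > −pq.
  part₁ : (k j : ℤ) → k < p * q → (- r) < j → j < r →
    InS p q r (k * r + j) ⇔ InS p q s (k * s + j)
  part₁ k j _ -r<j j<r = invariance j<r (<-trans (neg-mono-< P>0) r+j>0) k
    where
    r+j>0 : + 0 < r + j
    r+j>0 = subst (_< r + j) (+-inverseʳ r) (+-monoʳ-< r -r<j)

  -- c = j − r: here j − r < 0 < r and r + (j − r) = j > −pq.
  part₂ : (k j : ℤ) → k < p * q → (- (r ⊓ (p * q))) < j → j < (r ⊓ (p * q)) →
    InS p q r (k * r + j - r) ⇔ InS p q s (k * s + j - r)
  part₂ k j _ -m<j j<m =
    subst₂ (λ a b → InS p q r a ⇔ InS p q s b)
      (sym (+-assoc (k * r) j (- r))) (sym (+-assoc (k * s) j (- r)))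
      (invariance j-r<r -P<r+[j-r] k)
    where
    j-r<r : j - r < r
    j-r<r = <-trans (subst (j - r <_) (+-inverseʳ r)
      (+-monoˡ-< (- r) (<-≤-trans j<m (i⊓j≤i r (p * q))))) r>0
    -P<r+[j-r] : - (p * q) < r + (j - r)
    -P<r+[j-r] = subst (- (p * q) <_) (sym (cancel r j))
      (≤-<-trans (neg-mono-≤ (i⊓j≤j r (p * q))) -m<j)
      where
      cancel : ∀ a b → a + (b - a) ≡ b
      cancel = solve-∀
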